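{- For any integers $k,m$ satisfying $k\ge m\ge 0$ there exists a $(4k,k,1,2m)$-graph.
   Context: For nonnegative integers $\alpha,a,\beta,b$, an $(\alpha,a,\beta,b)$-graph is a triangle-free graph with $\alpha+\beta$ vertices which has $\alpha$ vertices of degree $a$ and $\beta$ vertices of degree $b$ if $a\ne b$, and is $a$-regular if $a=b$. -}

module Defs where

open import Data.Nat using (ℕ; _+_)
open import Data.Bool using (Bool; true; false)
open import Data.Fin using (Fin; _↑ˡ_; _↑ʳ_)
open import Data.List using (List; filter; length)
open import Data.List using () renaming (allFin to allFinL)
open import Data.Product using (Σ; _×_)
open import Relation.Binary.PropositionalEquality using (_≡_)
open import Relation.Nullary using (¬_)
open import Data.Bool.Properties using () renaming (_≟_ to _≟B_)

record Graph (n : ℕ) : Set where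
  field
    adj   : Fin n → Fin n → Bool
    sym   : ∀ u v → adj u v ≡ adj v u
    irref : ∀ v → adj v v ≡ false
open Graph public

degree : ∀ {n} → Graph n → Fin n → ℕ
degree {n} G v = length (filter (λ u → adj G v u ≟B true) (allFinL n))

TriangleFree : ∀ {n} → Graph n → Set
TriangleFree {n} G =
  ∀ (u v w : Fin n) → ¬ (adj G u v ≡ true × adj G v w ≡ true × adj G u w ≡ true)

-- Up to relabelling
-- of vertices we take the first α vertices (i ↑ˡ β) to be those of degree a
-- and the last β (α ↑ʳ j) those of degree b.
IsGraphWithParams : (α a β b : ℕ) → Graph (α + β) → Set
IsGraphWithParams α a β b G =
  TriangleFree G
  × (∀ (i : Fin α) → degree G (i ↑ˡ β) ≡ a)
  × (∀ (j : Fin β) → degree G (α ↑ʳ j) ≡ b)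

Exists-αaβb-Graph : (α a β b : ℕ) → Set
Exists-αaβb-Graph α a β b = Σ (Graph (α + β)) (IsGraphWithParams α a β b)

-- Take four classes X₁, Y₁, X₂, Y₂ of k vertices each and one vertex z, and fix a set
-- M of indices.  Join X₁ to Y₁ and X₂ to Y₂ completely except for the matching
-- {xᵢ yᵢ : i ∈ M}, join Y₁ to Y₂ exactly by that matching, and join z to the xᵢ with
-- i ∈ M.  A vertex with index in M loses one neighbour on the complete side and gains
-- one elsewhere, so every vertex outside z has degree k, while z has degree 2|M|.
-- Every edge joins consecutive classes of the 5-cycle X₁ Y₁ Y₂ X₂ z, so the graph maps
-- homomorphically to C₅ and is triangle-free.  Taking M = {0, …, m - 1} gives the theorem.
module Submission where

open import Defs
open import Data.Nat using (ℕ; zero; suc; _+_; _*_; _≤_; s≤s; _<ᵇ_; _≡ᵇ_; _%_)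
open import Data.Nat.Properties using (+-suc; +-comm; +-identityʳ)
open import Data.Nat.Tactic.RingSolver using (solve-∀)
open import Data.Bool using (Bool; true; false; not; _∧_; _∨_; if_then_else_)
open import Data.Bool.Properties using (∨-comm; ∨-identityʳ; ∧-zeroʳ) renaming (_≟_ to _≟B_)
open import Data.Fin using (Fin; zero; suc; toℕ; splitAt; _↑ˡ_; _↑ʳ_; #_)
open import Data.Fin.Properties using (_≟_; all?)
open import Data.List using (filter; length; tabulate)
open import Data.Product using (_,_)
open import Data.Sum.Properties using ([,]-map)
open import Data.Vec.Functional using (Vector; _++_; _∷_; [])
open import Data.Vec.Functional.Properties using (lookup-++ˡ; lookup-++ʳ)
open import Data.Vec.Functional.Relation.Unary.All using (All)
open import Data.Vec.Functional.Relation.Unary.All.Properties using (++⁺)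
open import Function using (_∘_; id)
open import Relation.Binary.PropositionalEquality as ≡
  using (_≡_; refl; cong; cong₂; trans; subst; module ≡-Reasoning)
open import Relation.Nullary using (Dec; does; yes; no; contradiction)
open import Relation.Nullary.Decidable using (¬?; _×-dec_; from-yes)

count : ∀ n → (Fin n → Bool) → ℕ
count zero    f = 0
count (suc n) f = if f zero then suc (count n (f ∘ suc)) else count n (f ∘ suc)

count-cong : ∀ {n} {f g : Fin n → Bool} → (∀ i → f i ≡ g i) → count n f ≡ count n g
count-cong {zero}  eq = refl
count-cong {suc n} eq =
  cong₂ (λ b c → if b then suc c else c) (eq zero) (count-cong (eq ∘ suc))

count-false : ∀ n → count n (λ _ → false) ≡ 0
count-false zero    = refl
count-false (suc n) = count-false n

count-≟ : ∀ {n} (i : Fin n) → count n (λ j → does (i ≟ j)) ≡ 1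
count-≟ {suc n} zero    = cong suc (count-false n)
count-≟ {suc n} (suc i) = count-≟ i

count-not+count : ∀ n (f : Fin n → Bool) → count n (not ∘ f) + count n f ≡ n
count-not+count zero    f = refl
count-not+count (suc n) f with f zero | count-not+count n (f ∘ suc)
... | true  | eq = trans (+-suc _ _) (cong suc eq)
... | false | eq = cong suc eq

count-∘-++ : ∀ m {n} {A : Set} (p : A → Bool) (xs : Vector A m) (ys : Vector A n) →
             count (m + n) (p ∘ (xs ++ ys)) ≡ count m (p ∘ xs) + count n (p ∘ ys)
count-∘-++ zero    p xs ys = refl
count-∘-++ (suc m) p xs ys
  with p (xs zero)
     | trans (count-cong (cong p ∘ [,]-map ∘ splitAt m)) (count-∘-++ m p (xs ∘ suc) ys)
... | true  | eq = cong suc eq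
... | false | eq = eq

count-toℕ<ᵇ : ∀ {m n} → m ≤ n → count n (λ i → toℕ i <ᵇ m) ≡ m
count-toℕ<ᵇ {zero}  {n}     _         = count-false n
count-toℕ<ᵇ {suc m} {suc n} (s≤s m≤n) = cong suc (count-toℕ<ᵇ m≤n)

length-filter-tabulate : ∀ {n} {A : Set} (g : Fin n → A) (p : A → Bool) →
                         length (filter (λ a → p a ≟B true) (tabulate g)) ≡ count n (p ∘ g)
length-filter-tabulate {zero}  g p = refl
length-filter-tabulate {suc n} g p with p (g zero)
... | true  = cong suc (length-filter-tabulate (g ∘ suc) p)
... | false = length-filter-tabulate (g ∘ suc) p

degree≡count : ∀ {n} (G : Graph n) v → degree G v ≡ count n (adj G v)
degree≡count G v = length-filter-tabulate id (adj G v)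

IsHomomorphism : ∀ {m n} → Graph m → Graph n → (Fin m → Fin n) → Set
IsHomomorphism G H φ = ∀ u v → adj G u v ≡ true → adj H (φ u) (φ v) ≡ true

triangleFree-comap : ∀ {m n} (G : Graph m) (H : Graph n) (φ : Fin m → Fin n) →
                     IsHomomorphism G H φ → TriangleFree H → TriangleFree G
triangleFree-comap G H φ hom H-free u v w (uv , vw , uw) =
  H-free (φ u) (φ v) (φ w) (hom u v uv , hom v w vw , hom u w uw)

triangleFree? : ∀ {n} (G : Graph n) → Dec (TriangleFree G)
triangleFree? G = all? λ u → all? λ v → all? λ w →
  ¬? (adj G u v ≟B true ×-dec adj G v w ≟B true ×-dec adj G u w ≟B true)

_⟶_ : Fin 5 → Fin 5 → Bool
p ⟶ q = toℕ q ≡ᵇ suc (toℕ p) % 5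

C₅ : Graph 5
C₅ = record
  { adj   = λ p q → p ⟶ q ∨ q ⟶ p
  ; sym   = λ p q → ∨-comm (p ⟶ q) (q ⟶ p)
  ; irref = from-yes (all? λ p → (p ⟶ p ∨ p ⟶ p) ≟B false)
  }

C₅-triangleFree : TriangleFree C₅
C₅-triangleFree = from-yes (triangleFree? C₅)

∧-∨-∧⇒∨ : ∀ a b {x y} → (a ∧ x) ∨ (b ∧ y) ≡ true → a ∨ b ≡ true
∧-∨-∧⇒∨ true  _     _ = refl
∧-∨-∧⇒∨ false true  _ = refl

module C₅-BlowUp (k : ℕ) (M : Fin k → Bool) where

  data Vertex : Set where
    x₁ y₁ x₂ y₂ : Fin k → Vertex
    z           : Vertex

  part : Vertex → Fin 5
  part (x₁ _) = # 0
  part (y₁ _) = # 1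
  part (y₂ _) = # 2
  part (x₂ _) = # 3
  part z      = # 4

  matched : Fin k → Fin k → Bool
  matched i j = M i ∧ does (i ≟ j)

  weight : Vertex → Vertex → Bool
  weight (x₁ i) (y₁ j) = not (matched i j)
  weight (y₁ i) (y₂ j) = matched i j
  weight (y₂ j) (x₂ i) = not (matched i j)
  weight (x₂ i) z      = M i
  weight z      (x₁ i) = M i
  weight _      _      = false

  -- The conjunct part u ⟶ part v is implied by weight u v; it is there to make
  -- part a homomorphism to C₅ without a case analysis.
  edge : Vertex → Vertex → Bool
  edge u v = part u ⟶ part v ∧ weight u v

  _~_ : Vertex → Vertex → Bool
  u ~ v = edge u v ∨ edge v u

  ~-irrefl : ∀ v → v ~ v ≡ false
  ~-irrefl (x₁ _) = refl
  ~-irrefl (y₁ _) = refl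
  ~-irrefl (x₂ _) = refl
  ~-irrefl (y₂ _) = refl
  ~-irrefl z      = refl

  blocks : Vector Vertex (4 * k)
  blocks = x₁ ++ y₁ ++ x₂ ++ y₂ ++ []

  vertex : Fin (4 * k + 1) → Vertex
  vertex = blocks ++ z ∷ []

  G : Graph (4 * k + 1)
  G = record
    { adj   = λ u v → vertex u ~ vertex v
    ; sym   = λ u v → ∨-comm (edge (vertex u) (vertex v)) (edge (vertex v) (vertex u))
    ; irref = ~-irrefl ∘ vertex
    }

  part-homomorphism : IsHomomorphism G C₅ (part ∘ vertex)
  part-homomorphism u v = ∧-∨-∧⇒∨ (part (vertex u) ⟶ part (vertex v)) (part (vertex v) ⟶ part (vertex u))

  G-triangleFree : TriangleFree G
  G-triangleFree = triangleFree-comap G C₅ (part ∘ vertex) part-homomorphism C₅-triangleFree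

  matched-sym : ∀ i j → matched i j ≡ matched j i
  matched-sym i j with i ≟ j | j ≟ i
  ... | yes refl | yes _    = refl
  ... | yes refl | no i≢i   = contradiction refl i≢i
  ... | no i≢j   | yes refl = contradiction refl i≢j
  ... | no _     | no _     = trans (∧-zeroʳ (M i)) (≡.sym (∧-zeroʳ (M j)))

  count-matched : ∀ i → count k (matched i) ≡ (if M i then 1 else 0)
  count-matched i with M i
  ... | true  = count-≟ i
  ... | false = count-false k

  count-unmatched : ∀ i → count k (not ∘ matched i) + (if M i then 1 else 0) ≡ k
  count-unmatched i =
    trans (cong (count k (not ∘ matched i) +_) (≡.sym (count-matched i))) (count-not+count k (matched i))

  count-blocks : ∀ p → count (4 * k) (p ∘ blocks)
                       ≡ count k (p ∘ x₁) + (count k (p ∘ y₁) + (count k (p ∘ x₂) + (count k (p ∘ y₂) + 0)))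
  count-blocks p =
    trans (count-∘-++ k p x₁ _) (cong (count k (p ∘ x₁) +_)
    (trans (count-∘-++ k p y₁ _) (cong (count k (p ∘ y₁) +_)
    (trans (count-∘-++ k p x₂ _) (cong (count k (p ∘ x₂) +_)
    (count-∘-++ k p y₂ []))))))

  neighbourCount : Vertex → ℕ
  neighbourCount w =
    count k ((w ~_) ∘ x₁) + (count k ((w ~_) ∘ y₁) + (count k ((w ~_) ∘ x₂)
      + (count k ((w ~_) ∘ y₂) + (if w ~ z then 1 else 0))))

  degree≡neighbourCount : ∀ v → degree G v ≡ neighbourCount (vertex v)
  degree≡neighbourCount v = begin
    degree G v                          ≡⟨ degree≡count G v ⟩
    count (4 * k + 1) ((w ~_) ∘ vertex) ≡⟨ count-∘-++ (4 * k) (w ~_) blocks (z ∷ []) ⟩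
    count (4 * k) ((w ~_) ∘ blocks) + e ≡⟨ cong (_+ e) (count-blocks (w ~_)) ⟩
    (a + (b + (c + (d + 0)))) + e       ≡⟨ reassociate a b c d e ⟩
    neighbourCount w                    ∎
    where
    open ≡-Reasoning
    w : Vertex
    w = vertex v
    a b c d e : ℕ
    a = count k ((w ~_) ∘ x₁)
    b = count k ((w ~_) ∘ y₁)
    c = count k ((w ~_) ∘ x₂)
    d = count k ((w ~_) ∘ y₂)
    e = if w ~ z then 1 else 0
    reassociate : ∀ a b c d e → (a + (b + (c + (d + 0)))) + e ≡ a + (b + (c + (d + e)))
    reassociate = solve-∀

  -- Between classes that are not consecutive on the cycle, _~_ computes to false, so those
  -- counts disappear by count-false; an edge seen against its orientation reads b ∨ false.
  neighbourCount-x₁ : ∀ i → neighbourCount (x₁ i) ≡ k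
  neighbourCount-x₁ i rewrite count-false k =
    trans (cong (_+ _) (count-cong (∨-identityʳ ∘ not ∘ matched i))) (count-unmatched i)

  neighbourCount-y₁ : ∀ j → neighbourCount (y₁ j) ≡ k
  neighbourCount-y₁ j rewrite count-false k = begin
    count k (λ i → not (matched i j)) + (count k (λ i → matched j i ∨ false) + 0)
      ≡⟨ cong₂ _+_ (count-cong (cong not ∘ λ i → matched-sym i j))
                   (trans (+-identityʳ _) (trans (count-cong (∨-identityʳ ∘ matched j)) (count-matched j))) ⟩
    count k (not ∘ matched j) + (if M j then 1 else 0)
      ≡⟨ count-unmatched j ⟩
    k ∎
    where open ≡-Reasoning

  neighbourCount-x₂ : ∀ i → neighbourCount (x₂ i) ≡ k
  neighbourCount-x₂ i rewrite count-false k | ∨-identityʳ (M i) = count-unmatched i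

  neighbourCount-y₂ : ∀ j → neighbourCount (y₂ j) ≡ k
  neighbourCount-y₂ j rewrite count-false k = begin
    count k (λ i → matched i j) + (count k (λ i → not (matched i j) ∨ false) + 0)
      ≡⟨ cong₂ _+_ (trans (count-cong λ i → matched-sym i j) (count-matched j))
                   (trans (+-identityʳ _) (count-cong λ i → trans (∨-identityʳ _) (cong not (matched-sym i j)))) ⟩
    (if M j then 1 else 0) + count k (not ∘ matched j)
      ≡⟨ +-comm _ (count k (not ∘ matched j)) ⟩
    count k (not ∘ matched j) + (if M j then 1 else 0)
      ≡⟨ count-unmatched j ⟩
    k ∎
    where open ≡-Reasoning

  neighbourCount-z : neighbourCount z ≡ 2 * count k M
  neighbourCount-z rewrite count-false k = cong (_+ (count k M + 0)) (count-cong (∨-identityʳ ∘ M))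

  G-isGraphWithParams : IsGraphWithParams (4 * k) k 1 (2 * count k M) G
  G-isGraphWithParams = G-triangleFree , degree-blocks , degree-z
    where
    HasDegreeK : Vertex → Set
    HasDegreeK v = neighbourCount v ≡ k

    blocks-neighbourCount : All HasDegreeK blocks
    blocks-neighbourCount = ++⁺ HasDegreeK neighbourCount-x₁ (++⁺ HasDegreeK neighbourCount-y₁
      (++⁺ HasDegreeK neighbourCount-x₂ (++⁺ HasDegreeK neighbourCount-y₂ λ ())))

    degree-blocks : ∀ i → degree G (i ↑ˡ 1) ≡ k
    degree-blocks i = trans (degree≡neighbourCount (i ↑ˡ 1))
      (trans (cong neighbourCount (lookup-++ˡ blocks (z ∷ []) i)) (blocks-neighbourCount i))

    degree-z : ∀ j → degree G (4 * k ↑ʳ j) ≡ 2 * count k M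
    degree-z zero = trans (degree≡neighbourCount (4 * k ↑ʳ zero))
      (trans (cong neighbourCount (lookup-++ʳ blocks (z ∷ []) zero)) neighbourCount-z)

lemma5p2 : (k m : ℕ) → m ≤ k → Exists-αaβb-Graph (4 * k) k 1 (2 * m)
lemma5p2 k m m≤k =
  subst (Exists-αaβb-Graph (4 * k) k 1 ∘ (2 *_)) (count-toℕ<ᵇ m≤k) (G , G-isGraphWithParams)
  where open C₅-BlowUp k (λ i → toℕ i <ᵇ m)
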